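{- Let $U$ be a Milliken-Taylor ultrafilter on $\mathrm{FIN}$. Then $(U\cdot U,\supseteq)\equiv_T(U,\supseteq)$.
   Context: $\mathrm{FIN}=[\omega]^{<\omega}\setminus\{\emptyset\}$. A block sequence is a sequence $\langle x_i:i<n\rangle$ ($n\le\omega$) of elements of $\mathrm{FIN}$ with $\max(x_i)<\min(x_j)$ whenever $i<j$; $\mathrm{FIN}^{[\infty]}$ is the set of infinite block sequences. For $X=\langle x_i:i<\omega\rangle\in\mathrm{FIN}^{[\infty]}$, $[X]=\{\bigcup_{i\in F}x_i:F\in\mathrm{FIN}\}$; $X/m=\langle x_i:i\ge n\rangle$ where $n$ is least with $\min(x_n)>m$; $Y\le^*X$ iff there is $m$ with $[Y/m]\subseteq[X]$. An ultrafilter $U$ on $\mathrm{FIN}$ is Milliken-Taylor iff (1) for every $A\in U$ there is $X\in\mathrm{FIN}^{[\infty]}$ with $[X]\subseteq A$ and $[X]\in U$; and (2) whenever $X_0\ge^*X_1\ge^*\cdots$ are in $\mathrm{FIN}^{[\infty]}$ with each $[X_n]\in U$, there is $Y\in\mathrm{FIN}^{[\infty]}$ with $[Y]\in U$ and $X_n\ge^*Y$ for all $n$. For filters $U$ on $X$ and $V$ on $Y$, $U\cdot V$ is the filter on $X\times Y$ with $A\in U\cdot V$ iff $\{x:\{y:(x,y)\in A\}\in V\}\in U$. $P\le_T Q$ means there is $f:Q\to P$ sending cofinal subsets of $Q$ to cofinal subsets of $P$; $\equiv_T$ means both $\le_T$ directions. Filters are ordered by $\supseteq$. -}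

module Defs where

open import Level using (Level; _⊔_) renaming (suc to lsuc; zero to lzero)
open import Data.Nat using (ℕ; suc; _<_)
open import Data.List using (List; []; _∷_; concat; map)
open import Data.List.Relation.Unary.Linked using (Linked)
open import Data.List.Relation.Unary.All using (All)
open import Data.Product using (Σ; ∃; _×_; _,_)
open import Data.Sum using (_⊎_)
open import Data.Unit using (⊤)
open import Data.Empty using (⊥)
open import Relation.Nullary using (¬_)
open import Relation.Binary.PropositionalEquality using (_≡_)

-- FIN = finite nonempty subsets of ω, represented canonically as
-- strictly increasing nonempty lists  mn ∷ rest.

record FIN : Set where
  constructor fin
  field
    mn   : ℕ
    rest : List ℕ
    incr : Linked _<_ (mn ∷ rest)

elems : FIN → List ℕ
elems x = FIN.mn x ∷ FIN.rest x

minF : FIN → ℕ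
minF = FIN.mn

lastOr : ℕ → List ℕ → ℕ
lastOr a []      = a
lastOr a (b ∷ l) = lastOr b l

maxF : FIN → ℕ
maxF x = lastOr (FIN.mn x) (FIN.rest x)

record BlockSeq : Set where
  constructor blockSeq
  field
    blk     : ℕ → FIN
    ordered : ∀ i j → i < j → maxF (blk i) < minF (blk j)

open BlockSeq public

-- ⋃_{i ∈ F} x_i  (as the increasing list of its elements; since the
-- blocks are ordered this is the concatenation in increasing order of i)
unionList : BlockSeq → FIN → List ℕ
unionList X F = concat (map (λ i → elems (blk X i)) (elems F))

⟦_⟧ : BlockSeq → FIN → Set
⟦ X ⟧ z = Σ FIN λ F → elems z ≡ unionList X F

-- [X/m] = { ⋃_{i∈F} x_i : F ∈ FIN, every i ∈ F has min(x_i) > m }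
-- (X/m is the tail of X consisting of the blocks with min > m)
⟦_/_⟧ : BlockSeq → ℕ → FIN → Set
⟦ X / m ⟧ z = Σ FIN λ F → All (λ i → m < minF (blk X i)) (elems F)
                          × (elems z ≡ unionList X F)

_≤*_ : BlockSeq → BlockSeq → Set
Y ≤* X = ∃ λ m → ∀ z → ⟦ Y / m ⟧ z → ⟦ X ⟧ z

record IsUltrafilter {S : Set} (U : (S → Set) → Set) : Set₁ where
  field
    full   : U (λ _ → ⊤)
    proper : ¬ U (λ _ → ⊥)
    upward : ∀ A B → (∀ x → A x → B x) → U A → U B
    meet   : ∀ A B → U A → U B → U (λ x → A x × B x)
    ultra  : ∀ A → U A ⊎ U (λ x → ¬ A x)

record MillikenTaylor (U : (FIN → Set) → Set) : Set₁ where
  field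
    isUltrafilter : IsUltrafilter U
    condition1 : ∀ A → U A → Σ BlockSeq λ X → (∀ z → ⟦ X ⟧ z → A z) × U ⟦ X ⟧
    condition2 : (X : ℕ → BlockSeq) → (∀ n → X (suc n) ≤* X n) →
                 (∀ n → U ⟦ X n ⟧) →
                 Σ BlockSeq λ Y → U ⟦ Y ⟧ × (∀ n → Y ≤* X n)

_·_ : {S T : Set} → ((S → Set) → Set) → ((T → Set) → Set) →
      ((Σ S (λ _ → T)) → Set) → Set
(U · V) A = U (λ x → V (λ y → A (x , y)))

Elt : {S : Set} → ((S → Set) → Set) → Set₁
Elt {S} U = Σ (S → Set) U

_⊇ᶠ_ : {S : Set} {U : (S → Set) → Set} → Elt U → Elt U → Set
_⊇ᶠ_ {S} (A , _) (B , _) = ∀ x → B x → A x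

Cofinal : {a ℓ c : Level} {P : Set a} → (P → P → Set ℓ) → (P → Set c) → Set (a ⊔ ℓ ⊔ c)
Cofinal {P = P} _≤_ C = ∀ p → Σ P λ q → C q × (p ≤ q)

Image : {a b c : Level} {P : Set a} {Q : Set b} → (Q → P) → (Q → Set c) → P → Set (a ⊔ b ⊔ c)
Image {Q = Q} f C p = Σ Q λ q → C q × (f q ≡ p)

TukeyLE : {a b ℓ₁ ℓ₂ : Level} (P : Set a) → (P → P → Set ℓ₁) → (Q : Set b) → (Q → Q → Set ℓ₂) →
          Set (a ⊔ lsuc b ⊔ ℓ₁ ⊔ ℓ₂)
TukeyLE {b = b} P _≤P_ Q _≤Q_ =
  Σ (Q → P) λ f → (C : Q → Set b) → Cofinal _≤Q_ C → Cofinal _≤P_ (Image f C)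

TukeyEq : {a b ℓ₁ ℓ₂ : Level} (P : Set a) → (P → P → Set ℓ₁) → (Q : Set b) → (Q → Q → Set ℓ₂) →
          Set (lsuc a ⊔ lsuc b ⊔ ℓ₁ ⊔ ℓ₂)
TukeyEq P ≤P Q ≤Q = TukeyLE P ≤P Q ≤Q × TukeyLE Q ≤Q P ≤P

{-# OPTIONS --safe #-}
module Submission where

open import Defs
open import Function using (_∘_)
open import Data.Nat using (ℕ; zero; suc; _+_; _≤_; _<_; z≤n; s≤s; _≤?_; _<?_)
open import Data.Nat.Properties
open import Data.Bool using (Bool; true; false; _xor_)
open import Data.Bool.Properties using (xor-assoc; xor-identityʳ; ¬-not)
open import Data.List using (List; []; _∷_; _++_; concat; map)
open import Data.List.Properties using (∷-injectiveˡ; ++-identityʳ; map-++; concat-++)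
open import Data.List.Relation.Unary.Linked as Linked using (Linked; []; [-]; _∷_)
open import Data.List.Relation.Unary.Linked.Properties using (Linked⇒All)
open import Data.List.Relation.Unary.All as All using (All; []; _∷_)
open import Data.Product using (Σ; _×_; _,_; proj₁; proj₂)
open import Data.Sum using (inj₁; inj₂)
open import Data.Unit using (⊤)
open import Data.Empty using (⊥; ⊥-elim)
open import Relation.Nullary using (¬_; yes; no)
open import Relation.Nullary.Decidable using (⌊_⌋)
open import Relation.Binary.PropositionalEquality

-- The projection (x , y) ↦ x gives U ≤_T U·U.  Conversely A ↦ FS A, the set of pairs
-- (x , y) with max x < min y and x, y, x ∪ y ∈ A, sends cofinal subsets of U to cofinal
-- subsets of U·U: given B ∈ U·U, the diagonalisation axiom (2) yields [Y] ∈ U and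
-- μ : ℕ → ℕ such that every y ∈ [Y] with min y > μ (max x) lies in the section B_x
-- whenever B_x ∈ U.  Colour z by the parity of the number of its consecutive elements
-- e < e' with e' ≤ μ e; the colour of x ∪ y is the sum of the colours of x and y and of
-- the gap between them, so inside the even class (which lies in U, since no [W] is
-- odd) x, y, x ∪ y ∈ A force min y > μ (max x).  Hence FS A ⊆ B as soon as A ⊆ E, where
-- E is [Y] ∩ { x : B_x ∈ U } ∩ even.

_⊆_ : {S : Set} → (S → Set) → (S → Set) → Set
A ⊆ B = ∀ x → A x → B x

linked-++ : ∀ {a r b s} → Linked _<_ (a ∷ r) → Linked _<_ (b ∷ s) →
            lastOr a r < b → Linked _<_ ((a ∷ r) ++ (b ∷ s))
linked-++ [-]     q a<b = a<b ∷ q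
linked-++ (h ∷ p) q a<b = h ∷ linked-++ p q a<b

head<tail : ∀ {a r} → Linked _<_ (a ∷ r) → All (a <_) r
head<tail [-]     = []
head<tail (h ∷ p) = Linked⇒All <-trans h p

head≤ : ∀ {a r} → Linked _<_ (a ∷ r) → All (a ≤_) (a ∷ r)
head≤ p = ≤-refl ∷ All.map <⇒≤ (head<tail p)

≤lastOr : ∀ {a r} → Linked _<_ (a ∷ r) → All (_≤ lastOr a r) (a ∷ r)
≤lastOr [-] = ≤-refl ∷ []
≤lastOr (h ∷ p) with ≤lastOr p
... | c≤last ∷ rest = ≤-trans (<⇒≤ h) c≤last ∷ c≤last ∷ rest

lastOr-++ : ∀ a r b s → lastOr a (r ++ b ∷ s) ≡ lastOr b s
lastOr-++ a []      b s = refl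
lastOr-++ a (c ∷ r) b s = lastOr-++ c r b s

elems-injective : ∀ {x x'} → elems x ≡ elems x' → x ≡ x'
elems-injective {fin m r p} {fin .m .r p'} refl = cong (fin m r) (Linked.irrelevant <-irrelevant p p')

minF≤maxF : ∀ x → minF x ≤ maxF x
minF≤maxF x = All.head (≤lastOr (FIN.incr x))

join : (x y : FIN) → maxF x < minF y → FIN
join x y x<y = fin (minF x) (FIN.rest x ++ elems y) (linked-++ (FIN.incr x) (FIN.incr y) x<y)

FS : (FIN → Set) → Σ FIN (λ _ → FIN) → Set
FS A (x , y) = A x × A y × Σ (maxF x < minF y) λ x<y → A (join x y x<y)

module _ (X : BlockSeq) where

  private
    blocks : List ℕ → List ℕ
    blocks l = concat (map (λ i → elems (blk X i)) l)

    last₀ : List ℕ → ℕ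
    last₀ []      = 0
    last₀ (a ∷ r) = lastOr a r

    last-blocks : ∀ i rs → last₀ (blocks (i ∷ rs)) ≡ maxF (blk X (lastOr i rs))
    last-blocks i []       = cong (lastOr (minF (blk X i))) (++-identityʳ (FIN.rest (blk X i)))
    last-blocks i (j ∷ rs) = trans (lastOr-++ (minF (blk X i)) (FIN.rest (blk X i)) (minF (blk X j)) _)
                                   (last-blocks j rs)

    blocks-++ : ∀ l l' → blocks (l ++ l') ≡ blocks l ++ blocks l'
    blocks-++ l l' = trans (cong concat (map-++ _ l l')) (sym (concat-++ (map _ l) (map _ l')))

  blk∈⟦⟧ : ∀ k → ⟦ X ⟧ (blk X k)
  blk∈⟦⟧ k = fin k [] [-] , sym (++-identityʳ (elems (blk X k)))

  minF-blk-mono : ∀ {i j} → i ≤ j → minF (blk X i) ≤ minF (blk X j)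
  minF-blk-mono {i} {j} i≤j with m≤n⇒m<n∨m≡n i≤j
  ... | inj₁ i<j  = ≤-trans (minF≤maxF (blk X i)) (<⇒≤ (ordered X i j i<j))
  ... | inj₂ refl = ≤-refl

  ≤minF-blk : ∀ k → k ≤ minF (blk X k)
  ≤minF-blk zero    = z≤n
  ≤minF-blk (suc k) = ≤-<-trans (≤-trans (≤minF-blk k) (minF≤maxF (blk X k))) (ordered X k (suc k) ≤-refl)

  ordered⁻¹ : ∀ {i j} → maxF (blk X i) < minF (blk X j) → i < j
  ordered⁻¹ {i} {j} gap with i <? j
  ... | yes i<j = i<j
  ... | no  i≮j = ⊥-elim (<⇒≱ gap (≤-trans (minF-blk-mono (≮⇒≥ i≮j)) (minF≤maxF (blk X i))))

  minF-⋃ : ∀ z F → elems z ≡ unionList X F → minF z ≡ minF (blk X (minF F))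
  minF-⋃ z F = ∷-injectiveˡ

  maxF-⋃ : ∀ z F → elems z ≡ unionList X F → maxF z ≡ maxF (blk X (maxF F))
  maxF-⋃ z F e = trans (cong last₀ e) (last-blocks (minF F) (FIN.rest F))

  ⟦⟧-join : ∀ x y → ⟦ X ⟧ x → ⟦ X ⟧ y → (x<y : maxF x < minF y) → ⟦ X ⟧ (join x y x<y)
  ⟦⟧-join x y (F , ex) (G , ey) x<y = join F G F<G , (begin
      elems x ++ elems y                      ≡⟨ cong₂ _++_ ex ey ⟩
      blocks (elems F) ++ blocks (elems G)    ≡⟨ blocks-++ (elems F) (elems G) ⟨
      blocks (elems F ++ elems G)             ∎)
    where
    open ≡-Reasoning
    F<G : maxF F < minF G
    F<G = ordered⁻¹ (subst₂ _<_ (maxF-⋃ x F ex) (minF-⋃ y G ey) x<y)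

  ⟦⟧⇒⟦/⟧ : ∀ {m} z → ⟦ X ⟧ z → m < minF z → ⟦ X / m ⟧ z
  ⟦⟧⇒⟦/⟧ z (F , e) m<z =
    F , All.map (λ F≤i → <-≤-trans m<z (subst (_≤ _) (sym (minF-⋃ z F e)) (minF-blk-mono F≤i)))
                (head≤ (FIN.incr F)) , e

⟦/⟧⊆⟦⟧ : ∀ X m → ⟦ X / m ⟧ ⊆ ⟦ X ⟧
⟦/⟧⊆⟦⟧ X m z (F , _ , e) = F , e

⊆⇒≤* : ∀ Y X → ⟦ Y ⟧ ⊆ ⟦ X ⟧ → Y ≤* X
⊆⇒≤* Y X Y⊆X = 0 , λ z → Y⊆X z ∘ ⟦/⟧⊆⟦⟧ Y 0 z

xor-sandwich : ∀ b n → b xor (n xor b) ≡ n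
xor-sandwich false n     = xor-identityʳ n
xor-sandwich true  false = refl
xor-sandwich true  true  = refl

module Parity (H : ℕ → ℕ) where

  near : ℕ → ℕ → Bool
  near e e' = ⌊ e' ≤? H e ⌋

  parity : List ℕ → Bool
  parity []           = false
  parity (e ∷ [])     = false
  parity (e ∷ e' ∷ l) = near e e' xor parity (e' ∷ l)

  parity-++ : ∀ a r b s →
    parity ((a ∷ r) ++ (b ∷ s)) ≡ parity (a ∷ r) xor (near (lastOr a r) b xor parity (b ∷ s))
  parity-++ a []      b s = refl
  parity-++ a (c ∷ r) b s =
    trans (cong (near a c xor_) (parity-++ c r b s)) (sym (xor-assoc (near a c) (parity (c ∷ r)) _))

  parityF : FIN → Bool
  parityF x = parity (elems x)

  near-monochromatic : ∀ x y {b} (x<y : maxF x < minF y) →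
    parityF x ≡ b → parityF y ≡ b → parityF (join x y x<y) ≡ b → near (maxF x) (minF y) ≡ b
  near-monochromatic x y {b} x<y px py pj = begin
      n                                ≡⟨ xor-sandwich b n ⟨
      b xor (n xor b)                  ≡⟨ cong₂ (λ c d → c xor (n xor d)) px py ⟨
      parityF x xor (n xor parityF y)  ≡⟨ parity-++ (minF x) (FIN.rest x) (minF y) (FIN.rest y) ⟨
      parityF (join x y x<y)           ≡⟨ pj ⟩
      b                                ∎
    where
    open ≡-Reasoning
    n = near (maxF x) (minF y)

  near-true : ∀ {e e'} → near e e' ≡ true → e' ≤ H e
  near-true {e} {e'} eq with e' ≤? H e
  ... | yes e'≤He = e'≤He

  near-false : ∀ {e e'} → near e e' ≡ false → H e < e'
  near-false {e} {e'} eq with e' ≤? H e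
  ... | no e'≰He = ≰⇒> e'≰He

  even-gap : ∀ x y (x<y : maxF x < minF y) →
    parityF x ≡ false → parityF y ≡ false → parityF (join x y x<y) ≡ false → H (maxF x) < minF y
  even-gap x y x<y px py pj = near-false (near-monochromatic x y x<y px py pj)

module UltrafilterProperties {S : Set} {U : (S → Set) → Set} (uf : IsUltrafilter U) where
  open IsUltrafilter uf

  guarded-∈ : ∀ A → U (λ y → U A → A y)
  guarded-∈ A with ultra A
  ... | inj₁ uA  = upward A _ (λ y a _ → a) uA
  ... | inj₂ u¬A = upward (λ _ → ⊤) _ (λ y _ uA → ⊥-elim (proper (contradictory uA))) full
    where
    contradictory : U A → U (λ _ → ⊥)
    contradictory uA = upward _ _ (λ z (a , ¬a) → ¬a a) (meet _ _ uA u¬A)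

  ⋂-increasing : (Q : List ℕ → S → Set) → (∀ l → U (Q l)) → ∀ k d →
    U (λ y → ∀ l → Linked _<_ l → All (k ≤_) l → All (_< k + d) l → Q l y)
  ⋂-increasing Q uQ k zero = upward (Q []) _ only-[] (uQ [])
    where
    only-[] : ∀ y → Q [] y → ∀ l → Linked _<_ l → All (k ≤_) l → All (_< k + zero) l → Q l y
    only-[] y q []      _ _           _           = q
    only-[] y q (a ∷ _) _ (k≤a ∷ _) (a<k ∷ _) =
      ⊥-elim (<⇒≱ a<k (subst (_≤ a) (sym (+-identityʳ k)) k≤a))
  ⋂-increasing Q uQ k (suc d) =
    upward _ _ split (meet _ _ (⋂-increasing Q uQ (suc k) d)
                               (⋂-increasing (Q ∘ (k ∷_)) (uQ ∘ (k ∷_)) (suc k) d))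
    where
    shift : ∀ {l} → All (_< k + suc d) l → All (_< suc k + d) l
    shift = All.map (λ {e} → subst (e <_) (+-suc k d))
    split : ∀ y →
      (∀ l → Linked _<_ l → All (suc k ≤_) l → All (_< suc k + d) l → Q l y) ×
      (∀ l → Linked _<_ l → All (suc k ≤_) l → All (_< suc k + d) l → Q (k ∷ l) y) →
      ∀ l → Linked _<_ l → All (k ≤_) l → All (_< k + suc d) l → Q l y
    split y (avoid-k , start-k) [] lk _ _ = avoid-k [] lk [] []
    split y (avoid-k , start-k) (a ∷ r) lk (k≤a ∷ _) bounds with m≤n⇒m<n∨m≡n k≤a
    ... | inj₁ k<a  = avoid-k (a ∷ r) lk (k<a ∷ All.map (<-trans k<a) (head<tail lk)) (shift bounds)
    ... | inj₂ refl = start-k r (Linked.tail lk) (head<tail lk) (shift (All.tail bounds))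

  ⋂-bounded : (G : FIN → S → Set) → (∀ x → U (G x)) → ∀ n → U (λ y → ∀ x → maxF x < n → G x y)
  ⋂-bounded G uG n = upward _ _ restrict (⋂-increasing Q uQ 0 n)
    where
    Q : List ℕ → S → Set
    Q l y = ∀ x → elems x ≡ l → G x y
    uQ : ∀ l → U (Q l)
    uQ [] = upward (λ _ → ⊤) _ (λ _ _ x ()) full
    uQ (a ∷ r) with Linked.linked? _<?_ (a ∷ r)
    ... | yes p = upward (G (fin a r p)) _ (λ y g x e → subst (λ x → G x y) (sym (elems-injective e)) g) (uG _)
    ... | no ¬p = upward (λ _ → ⊤) _ (λ y _ x e → ⊥-elim (¬p (subst (Linked _<_) e (FIN.incr x)))) full
    restrict : ∀ y → (∀ l → Linked _<_ l → All (0 ≤_) l → All (_< n) l → Q l y) →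
               ∀ x → maxF x < n → G x y
    restrict y q x x<n =
      q (elems x) (FIN.incr x) (All.tabulate (λ _ → z≤n))
        (All.map (λ e≤ → ≤-<-trans e≤ x<n) (≤lastOr (FIN.incr x))) x refl

module _ {S T : Set} {U : (S → Set) → Set} {V : (T → Set) → Set}
         (ufU : IsUltrafilter U) (ufV : IsUltrafilter V) (V-inhabited : ∀ {B} → V B → Σ T B) where

  dom : (Σ S (λ _ → T) → Set) → S → Set
  dom B x = Σ T λ y → B (x , y)

  U≤ᵀU·V : TukeyLE (Elt U) _⊇ᶠ_ (Elt (U · V)) _⊇ᶠ_
  U≤ᵀU·V = project , preserves
    where
    open IsUltrafilter ufU using (upward)
    open IsUltrafilter ufV using () renaming (upward to upwardᵛ; full to fullᵛ)
    project : Elt (U · V) → Elt U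
    project (B , uB) = dom B , upward _ (dom B) (λ x → V-inhabited) uB
    cylinder : Elt U → Elt (U · V)
    cylinder (A , uA) = A ∘ proj₁ , upward A _ (λ x a → upwardᵛ _ _ (λ _ _ → a) fullᵛ) uA
    preserves : (C : Elt (U · V) → Set₁) → Cofinal _⊇ᶠ_ C → Cofinal _⊇ᶠ_ (Image project C)
    preserves C cof A with cof (cylinder A)
    ... | q , q∈C , q⊆A = project q , (q , q∈C , refl) , λ x (y , b) → q⊆A (x , y) b

module MillikenTaylorProperties (U : (FIN → Set) → Set) (mt : MillikenTaylor U) where
  open MillikenTaylor mt
  open IsUltrafilter isUltrafilter
  open UltrafilterProperties isUltrafilter

  ∈⇒inhabited : ∀ {A} → U A → Σ FIN A
  ∈⇒inhabited uA with condition1 _ uA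
  ... | X , X⊆A , _ = blk X 0 , X⊆A _ (blk∈⟦⟧ X 0)

  ∈-if-meets-all-blocks : ∀ P → (∀ X → ¬ (⟦ X ⟧ ⊆ (¬_ ∘ P))) → U P
  ∈-if-meets-all-blocks P meets with ultra P
  ... | inj₁ uP  = uP
  ... | inj₂ u¬P with condition1 _ u¬P
  ... | X , X⊆¬P , _ = ⊥-elim (meets X X⊆¬P)

  tail-∈ : ∀ m → U (λ y → m < minF y)
  tail-∈ m = ∈-if-meets-all-blocks _ λ X X⊆¬ →
    X⊆¬ (blk X (suc m)) (blk∈⟦⟧ X (suc m)) (≤minF-blk X (suc m))

  even-∈ : ∀ H → U (λ z → Parity.parityF H z ≡ false)
  even-∈ H = ∈-if-meets-all-blocks _ no-odd-blocks
    where
    open Parity H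
    no-odd-blocks : ∀ W → ¬ (⟦ W ⟧ ⊆ (¬_ ∘ (λ z → parityF z ≡ false)))
    no-odd-blocks W all-odd = <⇒≱ (≤minF-blk W k) (near-true (near-monochromatic w₀ wₖ gap
      (odd w₀ w₀∈W) (odd wₖ wₖ∈W) (odd (join w₀ wₖ gap) (⟦⟧-join W w₀ wₖ w₀∈W wₖ∈W gap))))
      where
      w₀ = blk W 0
      k  = suc (H (maxF w₀))
      wₖ = blk W k
      w₀∈W = blk∈⟦⟧ W 0
      wₖ∈W = blk∈⟦⟧ W k
      gap : maxF w₀ < minF wₖ
      gap = ordered W 0 k (s≤s z≤n)
      odd : ∀ z → ⟦ W ⟧ z → parityF z ≡ true
      odd z z∈W = ¬-not {y = false} (all-odd z z∈W)

  FS-∈ : ∀ {A} → U A → (U · U) (FS A)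
  FS-∈ {A} uA with condition1 A uA
  ... | X , X⊆A , uX = upward ⟦ X ⟧ _ (λ x x∈X → upward _ _
          (λ y (y∈X , x<y) → X⊆A x x∈X , X⊆A y y∈X , x<y , X⊆A _ (⟦⟧-join X x y x∈X y∈X x<y))
          (meet _ _ uX (tail-∈ (maxF x)))) uX

  shrinking-sequence : (D : ℕ → FIN → Set) → (∀ n → U (D n)) →
    Σ (ℕ → BlockSeq) λ X → (∀ n → U ⟦ X n ⟧) × (∀ n → ⟦ X (suc n) ⟧ ⊆ (λ z → ⟦ X n ⟧ z × D n z))
  shrinking-sequence D uD = proj₁ ∘ seq , proj₂ ∘ seq , λ n → proj₂ (refine (seq n) (uD n))
    where
    Large = Σ BlockSeq λ X → U ⟦ X ⟧
    refine : (X : Large) → ∀ {A} → U A → Σ Large λ X' → ⟦ proj₁ X' ⟧ ⊆ (λ z → ⟦ proj₁ X ⟧ z × A z)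
    refine (X , uX) uA with condition1 _ (meet _ _ uX uA)
    ... | X' , X'⊆ , uX' = (X' , uX') , X'⊆
    seq : ℕ → Large
    seq zero    = let (X , _ , uX) = condition1 _ full in X , uX
    seq (suc n) = proj₁ (refine (seq n) (uD n))

  diagonalise : (D : ℕ → FIN → Set) → (∀ n → U (D n)) →
    Σ BlockSeq λ Y → U ⟦ Y ⟧ × Σ (ℕ → ℕ) λ μ → ∀ n → ⟦ Y / μ n ⟧ ⊆ D n
  diagonalise D uD with shrinking-sequence D uD
  ... | X , uX , shrinks
    with condition2 X (λ n → ⊆⇒≤* (X (suc n)) (X n) (λ z z∈ → proj₁ (shrinks n z z∈))) uX
  ... | Y , uY , Y≤*X =
    Y , uY , (λ n → proj₁ (Y≤*X (suc n))) , λ n z z∈ → proj₂ (shrinks n z (proj₂ (Y≤*X (suc n)) z z∈))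

  FS-refines : ∀ B → (U · U) B → Σ (FIN → Set) λ E → U E × (∀ A → A ⊆ E → FS A ⊆ B)
  FS-refines B uB with diagonalise D (λ n → ⋂-bounded _ (λ x → guarded-∈ _) (suc n))
    where
    D : ℕ → FIN → Set
    D n y = ∀ x → maxF x < suc n → U (λ y' → B (x , y')) → B (x , y)
  ... | Y , uY , μ , Y/μ⊆D = E , meet _ _ uY (meet _ _ uB (even-∈ μ)) , FS⊆B
    where
    open Parity μ
    E : FIN → Set
    E z = ⟦ Y ⟧ z × U (λ y → B (z , y)) × parityF z ≡ false
    FS⊆B : ∀ A → A ⊆ E → FS A ⊆ B
    FS⊆B A A⊆E (x , y) (x∈A , y∈A , x<y , j∈A)
      with A⊆E x x∈A | A⊆E y y∈A | A⊆E _ j∈A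
    ... | _ , uBx , even-x | y∈Y , _ , even-y | _ , _ , even-j =
      Y/μ⊆D (maxF x) y (⟦⟧⇒⟦/⟧ Y y y∈Y (even-gap x y x<y even-x even-y even-j)) x ≤-refl uBx

  U·U≤ᵀU : TukeyLE (Elt (U · U)) _⊇ᶠ_ (Elt U) _⊇ᶠ_
  U·U≤ᵀU = FS↑ , preserves
    where
    FS↑ : Elt U → Elt (U · U)
    FS↑ (A , uA) = FS A , FS-∈ uA
    preserves : (C : Elt U → Set₁) → Cofinal _⊇ᶠ_ C → Cofinal _⊇ᶠ_ (Image FS↑ C)
    preserves C cof (B , uB) with FS-refines B uB
    ... | E , uE , FS⊆B with cof (E , uE)
    ... | A , A∈C , A⊆E = FS↑ A , (A , A∈C , refl) , FS⊆B (proj₁ A) A⊆E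

theorem4p7 : (U : (FIN → Set) → Set) → MillikenTaylor U →
    TukeyEq (Elt (U · U)) _⊇ᶠ_ (Elt U) _⊇ᶠ_
theorem4p7 U mt = U·U≤ᵀU , U≤ᵀU·V isUltrafilter isUltrafilter ∈⇒inhabited
  where
  open MillikenTaylor mt
  open MillikenTaylorProperties U mt
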